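{- (Soundness of CPRHL.) If there is a CPRHL-proof of a partial reverse Hoare triple $\{P\}\,C\,\{Q\}$, then $\{P\}\,C\,\{Q\}$ is valid.
   Context: States $\sigma:\mathrm{Var}\to\mathbb{N}$; expressions $E ::= x\mid n\mid f(E,\dots,E)$; Boolean conditions $B ::= Q(E,\dots,E)\mid E=E\mid E\le E\mid\neg B\mid B\wedge B\mid B\vee B$; programs $C ::= \varepsilon\mid C'$, $C' ::= x:=E\mid C';C'\mid\mathtt{while}\ B\ \mathtt{do}\ C\mid C\ \mathtt{or}\ C$ ($\varepsilon$ the empty program; $C_0;C_1$ denotes $C_i$ when $C_{1-i}=\varepsilon$); assertions are first-order formulas over Boolean conditions interpreted over $\mathbb{N}$; $P\models Q$ is semantic entailment; $P[x:=E]$ is substitution. Small-step semantics: $\langle x:=E,\sigma\rangle\to\langle\varepsilon,\sigma[x\mapsto[\![E]\!]\sigma]\rangle$; $\langle\mathtt{while}\ B\ \mathtt{do}\ C,\sigma\rangle\to\langle C;\mathtt{while}\ B\ \mathtt{do}\ C,\sigma\rangle$ if $B$ holds in $\sigma$, else $\to\langle\varepsilon,\sigma\rangle$; $\langle C_0;C_1,\sigma\rangle\to\langle C_0';C_1,\sigma'\rangle$ if $\langle C_0,\sigma\rangle\to\langle C_0',\sigma'\rangle$; $\langle C_0\ \mathtt{or}\ C_1,\sigma\rangle\to\langle C_i,\sigma\rangle$ ($i=0,1$); $\to^{*}$ the reflexive-transitive closure. A triple $\{P\}C\{Q\}$ is valid if for all $\sigma'\models Q$ and all $\sigma$ with $\langle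 C,\sigma\rangle\to^{*}\langle\varepsilon,\sigma'\rangle$, $\sigma\models P$. CPRHL rules: (Axiom) $\{Q\}\,\varepsilon\,\{Q\}$; (Cons) from $\{P'\}C\{Q'\}$ infer $\{P\}C\{Q\}$ provided $P'\models P$ and $Q\models Q'$; (Assign) from $\{P\}C\{Q\}$ infer $\{P[x:=E]\}\,x:=E;C\,\{Q\}$; (Or) from $\{P\}C_0;C\{Q\}$ and $\{P\}C_1;C\{Q\}$ infer $\{P\}\,(C_0\ \mathtt{or}\ C_1);C\,\{Q\}$; (While) from $\{\neg B\to P\}C'\{Q\}$ and $\{B\to P\}\,C;\mathtt{while}\ B\ \mathtt{do}\ C;C'\,\{Q\}$ infer $\{P\}\,\mathtt{while}\ B\ \mathtt{do}\ C;C'\,\{Q\}$. A leaf of a finite derivation tree built from these rules is open if it is not an instance of Axiom; a companion of a leaf is an inner node labelled with the same triple. A CPRHL-pre-proof is a pair $(\mathcal{D},\mathcal{L})$ of a finite derivation tree $\mathcal{D}$ and a function $\mathcal{L}$ mapping each open leaf to one of its companions; it determines a (possibly infinite) graph of paths following back-links. It is a CPRHL-proof if along every infinite path rules other than Cons are applied infinitely often. -}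

module Defs where

open import Data.Nat using (ℕ; suc; _≤_; _≟_)
open import Data.Fin using (Fin)
open import Data.Vec using (Vec; []; _∷_; lookup)
open import Data.List using (List; []; _∷_; _++_)
open import Data.Product using (Σ; ∃; _×_; _,_; proj₁; proj₂)
open import Data.Unit using (⊤)
open import Data.Empty using (⊥)
open import Relation.Nullary using (¬_; yes; no)
open import Relation.Binary.PropositionalEquality using (_≡_)
open import Relation.Binary.Construct.Closure.ReflexiveTransitive using (Star; _◅_)
open import Data.Sum using (_⊎_)

record Lang : Set₁ where
  field
    Fun    : Set
    fArity : Fun → ℕ
    fSem   : (f : Fun) → Vec ℕ (fArity f) → ℕ
    Pred   : Set
    pArity : Pred → ℕ
    pSem   : (q : Pred) → Vec ℕ (pArity q) → Set

Var : Set
Var = ℕ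

State : Set
State = Var → ℕ

_[_↦_] : State → Var → ℕ → State
(σ [ x ↦ n ]) y with x ≟ y
... | yes _ = n
... | no  _ = σ y

module _ (L : Lang) where
  open Lang L

  data Exp : Set where
    var : Var → Exp
    num : ℕ → Exp
    app : (f : Fun) → Vec Exp (fArity f) → Exp

  mutual
    ⟦_⟧E : Exp → State → ℕ
    ⟦ var x ⟧E σ = σ x
    ⟦ num n ⟧E σ = n
    ⟦ app f es ⟧E σ = fSem f (⟦ es ⟧Es σ)

    ⟦_⟧Es : ∀ {n} → Vec Exp n → State → Vec ℕ n
    ⟦ [] ⟧Es σ = []
    ⟦ e ∷ es ⟧Es σ = ⟦ e ⟧E σ ∷ ⟦ es ⟧Es σ

  data BExp : Set where
    bpred : (q : Pred) → Vec Exp (pArity q) → BExp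
    beq   : Exp → Exp → BExp
    ble   : Exp → Exp → BExp
    bnot  : BExp → BExp
    band  : BExp → BExp → BExp
    bor   : BExp → BExp → BExp

  ⟦_⟧B : BExp → State → Set
  ⟦ bpred q es ⟧B σ = pSem q (⟦ es ⟧Es σ)
  ⟦ beq e₁ e₂ ⟧B σ = ⟦ e₁ ⟧E σ ≡ ⟦ e₂ ⟧E σ
  ⟦ ble e₁ e₂ ⟧B σ = ⟦ e₁ ⟧E σ ≤ ⟦ e₂ ⟧E σ
  ⟦ bnot b ⟧B σ = ¬ ⟦ b ⟧B σ
  ⟦ band b₁ b₂ ⟧B σ = ⟦ b₁ ⟧B σ × ⟦ b₂ ⟧B σ
  ⟦ bor b₁ b₂ ⟧B σ = ⟦ b₁ ⟧B σ ⊎ ⟦ b₂ ⟧B σ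

  -- Assertions: first-order formulas over Boolean conditions, with
  -- free variables the program variables and bound variables in
  -- de Bruijn form (Fin k); this makes substitution capture-free.

  data Tm (k : ℕ) : Set where
    var  : Var → Tm k
    bvar : Fin k → Tm k
    num  : ℕ → Tm k
    app  : (f : Fun) → Vec (Tm k) (fArity f) → Tm k

  data Fm (k : ℕ) : Set where
    fpred : (q : Pred) → Vec (Tm k) (pArity q) → Fm k
    feq   : Tm k → Tm k → Fm k
    fle   : Tm k → Tm k → Fm k
    ¬'_   : Fm k → Fm k
    _∧'_  : Fm k → Fm k → Fm k
    _∨'_  : Fm k → Fm k → Fm k
    _⇒'_  : Fm k → Fm k → Fm k
    ∀'    : Fm (suc k) → Fm k
    ∃'    : Fm (suc k) → Fm k

  Assertion : Set
  Assertion = Fm 0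

  mutual
    ⟦_⟧T : ∀ {k} → Tm k → State → Vec ℕ k → ℕ
    ⟦ var x ⟧T σ ρ = σ x
    ⟦ bvar i ⟧T σ ρ = lookup ρ i
    ⟦ num n ⟧T σ ρ = n
    ⟦ app f ts ⟧T σ ρ = fSem f (⟦ ts ⟧Ts σ ρ)

    ⟦_⟧Ts : ∀ {k n} → Vec (Tm k) n → State → Vec ℕ k → Vec ℕ n
    ⟦ [] ⟧Ts σ ρ = []
    ⟦ t ∷ ts ⟧Ts σ ρ = ⟦ t ⟧T σ ρ ∷ ⟦ ts ⟧Ts σ ρ

  ⟦_⟧F : ∀ {k} → Fm k → State → Vec ℕ k → Set
  ⟦ fpred q ts ⟧F σ ρ = pSem q (⟦ ts ⟧Ts σ ρ)
  ⟦ feq t u ⟧F σ ρ = ⟦ t ⟧T σ ρ ≡ ⟦ u ⟧T σ ρ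
  ⟦ fle t u ⟧F σ ρ = ⟦ t ⟧T σ ρ ≤ ⟦ u ⟧T σ ρ
  ⟦ ¬' φ ⟧F σ ρ = ¬ ⟦ φ ⟧F σ ρ
  ⟦ φ ∧' ψ ⟧F σ ρ = ⟦ φ ⟧F σ ρ × ⟦ ψ ⟧F σ ρ
  ⟦ φ ∨' ψ ⟧F σ ρ = ⟦ φ ⟧F σ ρ ⊎ ⟦ ψ ⟧F σ ρ
  ⟦ φ ⇒' ψ ⟧F σ ρ = ⟦ φ ⟧F σ ρ → ⟦ ψ ⟧F σ ρ
  ⟦ ∀' φ ⟧F σ ρ = (n : ℕ) → ⟦ φ ⟧F σ (n ∷ ρ)
  ⟦ ∃' φ ⟧F σ ρ = Σ ℕ λ n → ⟦ φ ⟧F σ (n ∷ ρ)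

  _⊨_ : State → Assertion → Set
  σ ⊨ P = ⟦ P ⟧F σ []

  _⊫_ : Assertion → Assertion → Set
  P ⊫ Q = ∀ σ → σ ⊨ P → σ ⊨ Q

  mutual
    embE : ∀ {k} → Exp → Tm k
    embE (var x) = var x
    embE (num n) = num n
    embE (app f es) = app f (embEs es)

    embEs : ∀ {k n} → Vec Exp n → Vec (Tm k) n
    embEs [] = []
    embEs (e ∷ es) = embE e ∷ embEs es

  embB : ∀ {k} → BExp → Fm k
  embB (bpred q es) = fpred q (embEs es)
  embB (beq e₁ e₂) = feq (embE e₁) (embE e₂)
  embB (ble e₁ e₂) = fle (embE e₁) (embE e₂)
  embB (bnot b) = ¬' embB b
  embB (band b₁ b₂) = embB b₁ ∧' embB b₂
  embB (bor b₁ b₂) = embB b₁ ∨' embB b₂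

  mutual
    substT : ∀ {k} → Tm k → Var → Exp → Tm k
    substT (var y) x E with x ≟ y
    ... | yes _ = embE E
    ... | no  _ = var y
    substT (bvar i) x E = bvar i
    substT (num n) x E = num n
    substT (app f ts) x E = app f (substTs ts x E)

    substTs : ∀ {k n} → Vec (Tm k) n → Var → Exp → Vec (Tm k) n
    substTs [] x E = []
    substTs (t ∷ ts) x E = substT t x E ∷ substTs ts x E

  substF : ∀ {k} → Fm k → Var → Exp → Fm k
  substF (fpred q ts) x E = fpred q (substTs ts x E)
  substF (feq t u) x E = feq (substT t x E) (substT u x E)
  substF (fle t u) x E = fle (substT t x E) (substT u x E)
  substF (¬' φ) x E = ¬' substF φ x E
  substF (φ ∧' ψ) x E = substF φ x E ∧' substF ψ x E
  substF (φ ∨' ψ) x E = substF φ x E ∨' substF ψ x E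
  substF (φ ⇒' ψ) x E = substF φ x E ⇒' substF ψ x E
  substF (∀' φ) x E = ∀' (substF φ x E)
  substF (∃' φ) x E = ∃' (substF φ x E)

  -- Programs.  A program is a (possibly empty) sequence of commands;
  -- ε = [] and sequential composition is _++_ (so ε;C = C;ε = C and
  -- composition is associative).

  data Cmd : Set where
    assign : Var → Exp → Cmd
    while  : BExp → List Cmd → Cmd
    choice : List Cmd → List Cmd → Cmd

  Prog : Set
  Prog = List Cmd

  ε : Prog
  ε = []

  data _⟶_ : Prog × State → Prog × State → Set where
    s-assign : ∀ {x E C σ} →
      (assign x E ∷ C , σ) ⟶ (C , σ [ x ↦ ⟦ E ⟧E σ ])
    s-whileT : ∀ {B D C σ} → ⟦ B ⟧B σ →
      (while B D ∷ C , σ) ⟶ (D ++ (while B D ∷ C) , σ)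
    s-whileF : ∀ {B D C σ} → ¬ ⟦ B ⟧B σ →
      (while B D ∷ C , σ) ⟶ (C , σ)
    s-orL : ∀ {C₀ C₁ C σ} → (choice C₀ C₁ ∷ C , σ) ⟶ (C₀ ++ C , σ)
    s-orR : ∀ {C₀ C₁ C σ} → (choice C₀ C₁ ∷ C , σ) ⟶ (C₁ ++ C , σ)

  _⟶*_ : Prog × State → Prog × State → Set
  _⟶*_ = Star _⟶_

  record Triple : Set where
    constructor ⟪_⟫_⟪_⟫
    field
      pre  : Assertion
      prog : Prog
      post : Assertion

  Valid : Triple → Set
  Valid ⟪ P ⟫ C ⟪ Q ⟫ =
    ∀ σ σ' → σ' ⊨ Q → (C , σ) ⟶* (ε , σ') → σ ⊨ P

  -- Finite derivation trees of CPRHL (bud = leaf that is not an Axiom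
  -- instance, to be equipped with a back-link)

  data Deriv : Triple → Set where
    axiom  : ∀ {Q} → Deriv ⟪ Q ⟫ ε ⟪ Q ⟫
    bud    : (t : Triple) → Deriv t
    cons   : ∀ {P P' C Q Q'} → P' ⊫ P → Q ⊫ Q' →
             Deriv ⟪ P' ⟫ C ⟪ Q' ⟫ → Deriv ⟪ P ⟫ C ⟪ Q ⟫
    assignR : ∀ {P x E C Q} →
             Deriv ⟪ P ⟫ C ⟪ Q ⟫ →
             Deriv ⟪ substF P x E ⟫ (assign x E ∷ C) ⟪ Q ⟫
    orR    : ∀ {P C₀ C₁ C Q} →
             Deriv ⟪ P ⟫ (C₀ ++ C) ⟪ Q ⟫ →
             Deriv ⟪ P ⟫ (C₁ ++ C) ⟪ Q ⟫ →
             Deriv ⟪ P ⟫ (choice C₀ C₁ ∷ C) ⟪ Q ⟫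
    whileR : ∀ {P B D C' Q} →
             Deriv ⟪ (¬' embB B) ⇒' P ⟫ C' ⟪ Q ⟫ →
             Deriv ⟪ embB B ⇒' P ⟫ (D ++ (while B D ∷ C')) ⟪ Q ⟫ →
             Deriv ⟪ P ⟫ (while B D ∷ C') ⟪ Q ⟫

  Node : Set
  Node = Σ Triple Deriv

  label : Node → Triple
  label = proj₁

  data _◁_ : Node → Node → Set where
    ◁cons    : ∀ {P P' C Q Q'} {h : P' ⊫ P} {h' : Q ⊫ Q'}
                 {d : Deriv ⟪ P' ⟫ C ⟪ Q' ⟫} →
               (_ , d) ◁ (⟪ P ⟫ C ⟪ Q ⟫ , cons h h' d)
    ◁assign  : ∀ {P x E C Q} {d : Deriv ⟪ P ⟫ C ⟪ Q ⟫} →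
               (_ , d) ◁ (_ , assignR {P} {x} {E} d)
    ◁orˡ     : ∀ {P C₀ C₁ C Q} {d : Deriv ⟪ P ⟫ (C₀ ++ C) ⟪ Q ⟫}
                 {e : Deriv ⟪ P ⟫ (C₁ ++ C) ⟪ Q ⟫} →
               (_ , d) ◁ (_ , orR {P} {C₀} {C₁} {C} {Q} d e)
    ◁orʳ     : ∀ {P C₀ C₁ C Q} {d : Deriv ⟪ P ⟫ (C₀ ++ C) ⟪ Q ⟫}
                 {e : Deriv ⟪ P ⟫ (C₁ ++ C) ⟪ Q ⟫} →
               (_ , e) ◁ (_ , orR {P} {C₀} {C₁} {C} {Q} d e)
    ◁whileˡ  : ∀ {P B D C' Q}
                 {d : Deriv ⟪ (¬' embB B) ⇒' P ⟫ C' ⟪ Q ⟫}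
                 {e : Deriv ⟪ embB B ⇒' P ⟫ (D ++ (while B D ∷ C')) ⟪ Q ⟫} →
               (_ , d) ◁ (_ , whileR d e)
    ◁whileʳ  : ∀ {P B D C' Q}
                 {d : Deriv ⟪ (¬' embB B) ⇒' P ⟫ C' ⟪ Q ⟫}
                 {e : Deriv ⟪ embB B ⇒' P ⟫ (D ++ (while B D ∷ C')) ⟪ Q ⟫} →
               (_ , e) ◁ (_ , whileR d e)

  -- positions (occurrences of nodes) in the tree rooted at r:
  -- a node m together with the path from m up to the root
  Pos : Node → Set
  Pos r = Σ Node λ m → Star _◁_ m r

  node : ∀ {r} → Pos r → Node
  node = proj₁

  IsBud : Node → Set
  IsBud (_ , bud _) = ⊤
  IsBud _ = ⊥

  IsInner : Node → Set
  IsInner (_ , cons _ _ _) = ⊤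
  IsInner (_ , assignR _) = ⊤
  IsInner (_ , orR _ _) = ⊤
  IsInner (_ , whileR _ _) = ⊤
  IsInner _ = ⊥

  IsNonCons : Node → Set
  IsNonCons (_ , assignR _) = ⊤
  IsNonCons (_ , orR _ _) = ⊤
  IsNonCons (_ , whileR _ _) = ⊤
  IsNonCons _ = ⊥

  record Links (r : Node) : Set where
    field
      link      : (p : Pos r) → IsBud (node p) → Pos r
      linkInner : (p : Pos r) (b : IsBud (node p)) → IsInner (node (link p b))
      linkSame  : (p : Pos r) (b : IsBud (node p)) →
                  label (node (link p b)) ≡ label (node p)

  Edge : ∀ {r} → Links r → Pos r → Pos r → Set
  Edge 𝓛 (m , π) (m' , π') =
    (Σ (m' ◁ m) λ s → π' ≡ s ◅ π)
    ⊎ (Σ (IsBud m) λ b → Links.link 𝓛 (m , π) b ≡ (m' , π'))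

  IsProof : ∀ {r} → Links r → Set
  IsProof {r} 𝓛 =
    (path : ℕ → Pos r) → (∀ i → Edge 𝓛 (path i) (path (suc i))) →
    ∀ i → ∃ λ j → i ≤ j × IsNonCons (node (path j))

{-# OPTIONS --safe #-}
module Submission where

-- Soundness is proved by induction on the execution, simultaneously for the triples at all
-- positions of the pre-proof. At a conclusion of Axiom, Assign, Or or While the first step of
-- the execution selects a premise, whose triple holds for the rest of the execution; Cons nodes
-- and buds pass the claim on to their premise or companion. The pre-proof has finitely many
-- positions, so a sequence of such moves that never reaches another rule runs into a cycle,
-- an infinite path on which only Cons is applied, which the global condition rules out.

open import Defs
open import Level using (0ℓ)
open import Function using (_∘_; _⇔_; mk⇔; Equivalence)
open import Function.Construct.Identity using (⇔-id)
open import Function.Related.TypeIsomorphisms using (→-cong-⇔; ¬-cong-⇔)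
open import Data.Product using (∃; ∃₂; _×_; _,_; proj₂)
open import Data.Product.Function.NonDependent.Propositional using (_×-⇔_)
open import Data.Sum using (_⊎_; inj₁; inj₂)
open import Data.Sum.Function.Propositional using (_⊎-⇔_)
open import Data.Nat using (ℕ; zero; suc; _≤_; _<_; _≟_; s≤s)
open import Data.Nat.Properties using (≤-trans; <⇒≤; m≤n⇒m<n∨m≡n; m<n⇒0<n; n<1+n)
open import Data.Fin using (Fin; toℕ)
open import Data.Fin.Properties using (pigeonhole; toℕ≤pred[n])
open import Data.Vec using (Vec; []; _∷_)
open import Data.List using (List; []; _∷_; _++_; length; lookup)
open import Data.List.Relation.Unary.Any using (here; there; index)
open import Data.List.Relation.Unary.Any.Properties using (lookup-index; ++⁺ˡ; ++⁺ʳ; ++⁻)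
open import Data.List.Membership.Propositional using (_∈_)
open import Data.Unit using (⊤; tt)
open import Data.Empty using (⊥; ⊥-elim)
open import Relation.Nullary using (¬_; yes; no)
open import Relation.Unary using (Pred; Decidable)
open import Relation.Binary.PropositionalEquality
  using (_≡_; refl; sym; cong; cong₂; subst; setoid; module ≡-Reasoning)
open import Relation.Binary.Construct.Closure.ReflexiveTransitive
  using (Star; _◅_) renaming (ε to ε⋆)

module Orbit {a} {A : Set a} (f : A → A) where
  open import Function.Endo.Propositional A using (_^_)
  open import Data.List.Relation.Unary.Enumerates.Setoid (setoid A) using (IsEnumeration)

  ^-suc′ : ∀ n x → (f ^ suc n) x ≡ (f ^ n) (f x)
  ^-suc′ zero    x = refl
  ^-suc′ (suc n) x = cong f (^-suc′ n x)

  orbit-within-cycle : ∀ {i j x} → i < j → (f ^ i) x ≡ (f ^ j) x →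
                       ∀ k → ∃ λ c → c < j × (f ^ k) x ≡ (f ^ c) x
  orbit-within-cycle i<j cycle zero = 0 , m<n⇒0<n i<j , refl
  orbit-within-cycle {i} {j} {x} i<j cycle (suc k)
    with orbit-within-cycle i<j cycle k
  ... | c , c<j , fᵏx≡fᶜx with m≤n⇒m<n∨m≡n c<j
  ...   | inj₁ 1+c<j = suc c , 1+c<j , cong f fᵏx≡fᶜx
  ...   | inj₂ 1+c≡j = i , i<j , (begin
          f ((f ^ k) x)  ≡⟨ cong f fᵏx≡fᶜx ⟩
          (f ^ suc c) x  ≡⟨ cong (λ n → (f ^ n) x) 1+c≡j ⟩
          (f ^ j) x      ≡⟨ sym cycle ⟩
          (f ^ i) x      ∎)
    where open ≡-Reasoning

  orbit-repeats : ∀ {xs} → IsEnumeration xs →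
                  ∀ x → ∃₂ λ i j → i < j × j ≤ length xs × (f ^ i) x ≡ (f ^ j) x
  orbit-repeats {xs} enum x =
    let i , j , i<j , same-slot = pigeonhole (n<1+n (length xs)) slot in
    toℕ i , toℕ j , i<j , toℕ≤pred[n] j , (begin
      (f ^ toℕ i) x               ≡⟨ lookup-index (enum _) ⟩
      lookup xs (slot i)          ≡⟨ cong (lookup xs) same-slot ⟩
      lookup xs (slot j)          ≡⟨ sym (lookup-index (enum _)) ⟩
      (f ^ toℕ j) x               ∎)
    where
    open ≡-Reasoning
    slot : Fin (suc (length xs)) → Fin (length xs)
    slot k = index (enum ((f ^ toℕ k) x))

  module _ {ℓ} (C : Pred A ℓ) where

    data Exits (x : A) : Set ℓ where
      exit     : ¬ C x → Exits x
      continue : C x → Exits (f x) → Exits x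

    Exits-elim : ∀ {g} (G : Pred A g) → (∀ x → C x → G (f x) → G x) →
                 (∀ x → ¬ C x → G x) → ∀ {x} → Exits x → G x
    Exits-elim G step stop (exit ¬c)      = stop _ ¬c
    Exits-elim G step stop (continue c e) = step _ c (Exits-elim G step stop e)

    module _ (C? : Decidable C) where

      exits-or-prefix : ∀ m x → Exits x ⊎ (∀ i → i ≤ m → C ((f ^ i) x))
      exits-or-prefix m x with C? x
      ... | no ¬c = inj₁ (exit ¬c)
      exits-or-prefix zero x | yes c = inj₂ λ { zero _ → c }
      exits-or-prefix (suc m) x | yes c with exits-or-prefix m (f x)
      ... | inj₁ e = inj₁ (continue c e)
      ... | inj₂ cs = inj₂ λ
        { zero    _           → c
        ; (suc i) (s≤s i≤m) → subst C (sym (^-suc′ i x)) (cs i i≤m) }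

      exits-or-stays : ∀ {xs} → IsEnumeration xs → ∀ x → Exits x ⊎ (∀ k → C ((f ^ k) x))
      exits-or-stays {xs} enum x with exits-or-prefix (length xs) x
      ... | inj₁ e  = inj₁ e
      ... | inj₂ cs = inj₂ stays
        where
        stays : ∀ k → C ((f ^ k) x)
        stays k =
          let i , j , i<j , j≤n , cycle = orbit-repeats enum x
              c , c<j , fᵏx≡fᶜx = orbit-within-cycle i<j cycle k
          in subst C (sym fᵏx≡fᶜx) (cs c (≤-trans (<⇒≤ c<j) j≤n))

module _ (L : Lang) where
  open Lang L using (fSem)

  mutual
    embE-sem : ∀ {k} e σ (ρ : Vec ℕ k) → ⟦_⟧T L (embE L e) σ ρ ≡ ⟦_⟧E L e σ
    embE-sem (var x)    σ ρ = refl
    embE-sem (num n)    σ ρ = refl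
    embE-sem (app f es) σ ρ = cong (fSem f) (embEs-sem es σ ρ)

    embEs-sem : ∀ {k n} (es : Vec (Exp L) n) σ (ρ : Vec ℕ k) →
                ⟦_⟧Ts L (embEs L es) σ ρ ≡ ⟦_⟧Es L es σ
    embEs-sem []       σ ρ = refl
    embEs-sem (e ∷ es) σ ρ = cong₂ _∷_ (embE-sem e σ ρ) (embEs-sem es σ ρ)

  embB-⇔ : ∀ {k} b σ (ρ : Vec ℕ k) → ⟦_⟧F L (embB L b) σ ρ ⇔ ⟦_⟧B L b σ
  embB-⇔ (bpred q es) σ ρ rewrite embEs-sem es σ ρ = ⇔-id _
  embB-⇔ (beq e₁ e₂)  σ ρ rewrite embE-sem e₁ σ ρ | embE-sem e₂ σ ρ = ⇔-id _
  embB-⇔ (ble e₁ e₂)  σ ρ rewrite embE-sem e₁ σ ρ | embE-sem e₂ σ ρ = ⇔-id _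
  embB-⇔ (bnot b)     σ ρ = ¬-cong-⇔ (embB-⇔ b σ ρ)
  embB-⇔ (band b₁ b₂) σ ρ = embB-⇔ b₁ σ ρ ×-⇔ embB-⇔ b₂ σ ρ
  embB-⇔ (bor b₁ b₂)  σ ρ = embB-⇔ b₁ σ ρ ⊎-⇔ embB-⇔ b₂ σ ρ

  mutual
    substT-sem : ∀ {k} (t : Tm L k) x E σ ρ →
                 ⟦_⟧T L (substT L t x E) σ ρ ≡ ⟦_⟧T L t (σ [ x ↦ ⟦_⟧E L E σ ]) ρ
    substT-sem (var y) x E σ ρ with x ≟ y
    ... | yes _ = embE-sem E σ ρ
    ... | no  _ = refl
    substT-sem (bvar i)   x E σ ρ = refl
    substT-sem (num n)    x E σ ρ = refl
    substT-sem (app f ts) x E σ ρ = cong (fSem f) (substTs-sem ts x E σ ρ)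

    substTs-sem : ∀ {k n} (ts : Vec (Tm L k) n) x E σ ρ →
                  ⟦_⟧Ts L (substTs L ts x E) σ ρ ≡ ⟦_⟧Ts L ts (σ [ x ↦ ⟦_⟧E L E σ ]) ρ
    substTs-sem []       x E σ ρ = refl
    substTs-sem (t ∷ ts) x E σ ρ = cong₂ _∷_ (substT-sem t x E σ ρ) (substTs-sem ts x E σ ρ)

  substF-⇔ : ∀ {k} (φ : Fm L k) x E σ ρ →
             ⟦_⟧F L (substF L φ x E) σ ρ ⇔ ⟦_⟧F L φ (σ [ x ↦ ⟦_⟧E L E σ ]) ρ
  substF-⇔ (fpred q ts) x E σ ρ rewrite substTs-sem ts x E σ ρ = ⇔-id _
  substF-⇔ (feq t u) x E σ ρ rewrite substT-sem t x E σ ρ | substT-sem u x E σ ρ = ⇔-id _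
  substF-⇔ (fle t u) x E σ ρ rewrite substT-sem t x E σ ρ | substT-sem u x E σ ρ = ⇔-id _
  substF-⇔ (¬' φ)   x E σ ρ = ¬-cong-⇔ (substF-⇔ φ x E σ ρ)
  substF-⇔ (φ ∧' ψ) x E σ ρ = substF-⇔ φ x E σ ρ ×-⇔ substF-⇔ ψ x E σ ρ
  substF-⇔ (φ ∨' ψ) x E σ ρ = substF-⇔ φ x E σ ρ ⊎-⇔ substF-⇔ ψ x E σ ρ
  substF-⇔ (φ ⇒' ψ) x E σ ρ = →-cong-⇔ (substF-⇔ φ x E σ ρ) (substF-⇔ ψ x E σ ρ)
  substF-⇔ (∀' φ)   x E σ ρ = mk⇔
    (λ h n → Equivalence.to   (substF-⇔ φ x E σ (n ∷ ρ)) (h n))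
    (λ h n → Equivalence.from (substF-⇔ φ x E σ (n ∷ ρ)) (h n))
  substF-⇔ (∃' φ)   x E σ ρ = mk⇔
    (λ (n , h) → n , Equivalence.to   (substF-⇔ φ x E σ (n ∷ ρ)) h)
    (λ (n , h) → n , Equivalence.from (substF-⇔ φ x E σ (n ∷ ρ)) h)

  -- Fixing the execution and matching the program by an equation lets soundness be proved by
  -- structural induction on the execution while the triple varies over the pre-proof.
  SoundFor : Prog L × State → State → Triple L → Set
  SoundFor (C , σ) σ' ⟪ P ⟫ C' ⟪ Q ⟫ = C' ≡ C → _⊨_ L σ' Q → _⊨_ L σ P

  IsConsOrBud : Node L → Set
  IsConsOrBud (_ , cons _ _ _) = ⊤
  IsConsOrBud (_ , bud _)      = ⊤
  IsConsOrBud _                = ⊥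

  isConsOrBud? : Decidable IsConsOrBud
  isConsOrBud? (_ , axiom)        = no λ ()
  isConsOrBud? (_ , bud _)        = yes tt
  isConsOrBud? (_ , cons _ _ _)   = yes tt
  isConsOrBud? (_ , assignR _)    = no λ ()
  isConsOrBud? (_ , orR _ _)      = no λ ()
  isConsOrBud? (_ , whileR _ _)   = no λ ()

  consOrBud⇒¬nonCons : ∀ m → IsConsOrBud m → ¬ IsNonCons L m
  consOrBud⇒¬nonCons (_ , cons _ _ _) _ ()
  consOrBud⇒¬nonCons (_ , bud _)      _ ()

  rule-sound-at-end : ∀ {σ'} m → ¬ IsConsOrBud m → SoundFor ([] , σ') σ' (label L m)
  rule-sound-at-end (_ , axiom)      _   refl hQ = hQ
  rule-sound-at-end (_ , bud _)      ¬cb = ⊥-elim (¬cb tt)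
  rule-sound-at-end (_ , cons _ _ _) ¬cb = ⊥-elim (¬cb tt)
  rule-sound-at-end (_ , assignR _)  _   ()
  rule-sound-at-end (_ , orR _ _)    _   ()
  rule-sound-at-end (_ , whileR _ _) _   ()

  rule-sound-step : ∀ {C σ c' σ'} m → ¬ IsConsOrBud m → _⟶_ L (C , σ) c' →
                    (∀ {m'} → _◁_ L m' m → SoundFor c' σ' (label L m')) →
                    SoundFor (C , σ) σ' (label L m)
  rule-sound-step (_ , axiom)      _   () _ refl
  rule-sound-step (_ , bud _)      ¬cb = ⊥-elim (¬cb tt)
  rule-sound-step (_ , cons _ _ _) ¬cb = ⊥-elim (¬cb tt)
  rule-sound-step {σ = σ} (_ , assignR {P} {x} {E} _) _ s-assign premise refl hQ =
    Equivalence.from (substF-⇔ P x E σ []) (premise ◁assign refl hQ)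
  rule-sound-step (_ , orR _ _) _ s-orL premise refl hQ = premise ◁orˡ refl hQ
  rule-sound-step (_ , orR _ _) _ s-orR premise refl hQ = premise ◁orʳ refl hQ
  rule-sound-step {σ = σ} (_ , whileR {B = B} _ _) _ (s-whileT b) premise refl hQ =
    premise ◁whileʳ refl hQ (Equivalence.from (embB-⇔ B σ []) b)
  rule-sound-step {σ = σ} (_ , whileR {B = B} _ _) _ (s-whileF ¬b) premise refl hQ =
    premise ◁whileˡ refl hQ (¬b ∘ Equivalence.to (embB-⇔ B σ []))

  module _ {r : Node L} where

    mutual
      positionsBelow : ∀ {t} (d : Deriv L t) → Star (_◁_ L) (t , d) r → List (Pos L r)
      positionsBelow d π = ((_ , d) , π) ∷ premisePositions d π

      premisePositions : ∀ {t} (d : Deriv L t) → Star (_◁_ L) (t , d) r → List (Pos L r)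
      premisePositions axiom          π = []
      premisePositions (bud _)        π = []
      premisePositions (cons _ _ d)   π = positionsBelow d (◁cons ◅ π)
      premisePositions (assignR d)    π = positionsBelow d (◁assign ◅ π)
      premisePositions (orR d e)      π =
        positionsBelow d (◁orˡ ◅ π) ++ positionsBelow e (◁orʳ ◅ π)
      premisePositions (whileR d e)   π =
        positionsBelow d (◁whileˡ ◅ π) ++ positionsBelow e (◁whileʳ ◅ π)

    premise∈premisePositions : ∀ {t} {d : Deriv L t} π {m} (s : _◁_ L m (t , d)) →
                               (m , s ◅ π) ∈ premisePositions d π
    premise∈premisePositions π ◁cons   = here refl
    premise∈premisePositions π ◁assign = here refl
    premise∈premisePositions {d = orR d _}    π ◁orˡ    = ++⁺ˡ {xs = positionsBelow d _} (here refl)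
    premise∈premisePositions {d = orR d _}    π ◁orʳ    = ++⁺ʳ (positionsBelow d _) (here refl)
    premise∈premisePositions {d = whileR d _} π ◁whileˡ = ++⁺ˡ {xs = positionsBelow d _} (here refl)
    premise∈premisePositions {d = whileR d _} π ◁whileʳ = ++⁺ʳ (positionsBelow d _) (here refl)

    positionsBelow-extend : ∀ {t} (d : Deriv L t) π {m π'} → (m , π') ∈ positionsBelow d π →
                            ∀ {m'} (s : _◁_ L m' m) → (m' , s ◅ π') ∈ positionsBelow d π
    positionsBelow-extend d π (here refl) s = there (premise∈premisePositions π s)
    positionsBelow-extend (cons _ _ d) π (there mem) s =
      there (positionsBelow-extend d _ mem s)
    positionsBelow-extend (assignR d) π (there mem) s =
      there (positionsBelow-extend d _ mem s)
    positionsBelow-extend (orR d e) π (there mem) s with ++⁻ (positionsBelow d _) mem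
    ... | inj₁ mem-d = there (++⁺ˡ {xs = positionsBelow d _} (positionsBelow-extend d _ mem-d s))
    ... | inj₂ mem-e = there (++⁺ʳ (positionsBelow d _) (positionsBelow-extend e _ mem-e s))
    positionsBelow-extend (whileR d e) π (there mem) s with ++⁻ (positionsBelow d _) mem
    ... | inj₁ mem-d = there (++⁺ˡ {xs = positionsBelow d _} (positionsBelow-extend d _ mem-d s))
    ... | inj₂ mem-e = there (++⁺ʳ (positionsBelow d _) (positionsBelow-extend e _ mem-e s))

    positions : List (Pos L r)
    positions = positionsBelow (proj₂ r) ε⋆

    ∈-positions : ∀ {m} (π : Star (_◁_ L) m r) → (m , π) ∈ positions
    ∈-positions ε⋆      = here refl
    ∈-positions (s ◅ π) = positionsBelow-extend (proj₂ r) ε⋆ (∈-positions π) s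

  module _ {r : Node L} (𝓛 : Links L r) where
    open import Function.Endo.Propositional (Pos L r) using (_^_)
    open Links 𝓛

    ConsOrBud : Pred (Pos L r) 0ℓ
    ConsOrBud = IsConsOrBud ∘ node L

    SoundAt : Prog L × State → State → Pos L r → Set
    SoundAt c σ' q = SoundFor c σ' (label L (node L q))

    follow : Pos L r → Pos L r
    follow ((_ , cons _ _ d) , π) = (_ , d) , ◁cons ◅ π
    follow q@((_ , bud _) , _)    = link q tt
    follow q                      = q

    follow-edge : ∀ q → ConsOrBud q → Edge L 𝓛 q (follow q)
    follow-edge ((_ , cons _ _ _) , _) _ = inj₁ (◁cons , refl)
    follow-edge ((_ , bud _) , _)      _ = inj₂ (tt , refl)

    follow-sound : ∀ {c σ'} q → ConsOrBud q → SoundAt c σ' (follow q) → SoundAt c σ' q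
    follow-sound {c = _ , σ} {σ'} ((_ , cons P'⊫P Q⊫Q' _) , _) _ sound C≡ hQ =
      P'⊫P σ (sound C≡ (Q⊫Q' σ' hQ))
    follow-sound {c} {σ'} q@((_ , bud _) , _) _ sound =
      subst (SoundFor c σ') (linkSame q tt) sound

    module _ (proof : IsProof L 𝓛) where
      open Orbit follow using (Exits; Exits-elim; exits-or-stays)

      exits : ∀ q → Exits ConsOrBud q
      exits q with exits-or-stays ConsOrBud (isConsOrBud? ∘ node L) (∈-positions ∘ proj₂) q
      ... | inj₁ e     = e
      ... | inj₂ stays =
        let j , _ , nonCons = proof (λ k → (follow ^ k) q) (λ k → follow-edge _ (stays k)) 0
        in ⊥-elim (consOrBud⇒¬nonCons _ (stays j) nonCons)

      mutual
        sound-along : ∀ {c σ'} → _⟶*_ L c ([] , σ') → ∀ q → SoundAt c σ' q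
        sound-along {c} {σ'} run q =
          Exits-elim ConsOrBud (SoundAt c σ') follow-sound (rule-sound-along run) (exits q)

        rule-sound-along : ∀ {c σ'} → _⟶*_ L c ([] , σ') → ∀ q → ¬ ConsOrBud q → SoundAt c σ' q
        rule-sound-along ε⋆        (m , _) ¬cb = rule-sound-at-end m ¬cb
        rule-sound-along (s ◅ run) (m , π) ¬cb =
          rule-sound-step m ¬cb s (λ m'◁m → sound-along run (_ , m'◁m ◅ π))

theorem4p4 : (L : Lang) (t : Triple L) (d : Deriv L t) (𝓛 : Links L (t , d)) →
    IsProof L 𝓛 → Valid L t
theorem4p4 L t d 𝓛 proof σ σ' hQ run = sound-along L 𝓛 proof run ((t , d) , ε⋆) refl hQ
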